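{- Let $(f,C)$ be a low-defect pair of degree $r>0$ and let $s$ be a real number with $0\le s<\delta(f,C)$. Then there exists a number $K$ such that for all nonnegative integers $k_1,\ldots,k_r$ with $\delta_{f,C}(k_1,\ldots,k_r)<s$, there is some $i$ such that $x_i$ is minimal in the nesting ordering of $f$ and $k_i\le K$.
   Context: $\|n\|$ is the least number of $1$'s needed to write $n\in\mathbb{N}$ using $1$, $+$, $\times$, parentheses. Low-defect expressions: (a) every positive integer constant is one; (b) the product of two low-defect expressions with disjoint variable sets is one; (c) if $E$ is one, $c$ a positive integer and $x$ a variable not in $E$, then $E\cdot x+c$ is one; $\|E\|$ is the sum of complexities of the constants in $E$. $(f,C)$ is a low-defect pair if $f$ is the polynomial obtained from some low-defect expression $E$ with $\|E\|\le C$; such $f$ of degree $r$ is multilinear in $x_1,\ldots,x_r$ with nonnegative integer coefficients and nonzero leading coefficient $a$ (coefficient of $x_1\cdots x_r$). $\delta(f,C)=C-3\log_3 a$ and $\delta_{f,C}(k_1,\ldots,k_r)=C+3(k_1+\cdots+k_r)-3\log_3 f(3^{k_1},\ldots,3^{k_r})$. Nesting ordering: for variables $x,y$ of a low-defect expression $E$, $x\preceq y$ iff $x$ appears in the smallest low-defect subexpression of $E$ containing $y$; this depends only on $f$.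
   Formalization: The number s ranges over the nonnegative rationals instead of the real numbers with $0\le s<\delta(f,C)$. -}

module Defs where

open import Data.Nat using (ℕ; zero; suc; _+_; _*_; _^_; _≤_; _<_)
open import Data.Fin using (Fin)
open import Data.List using (List; []; _∷_; _++_; map; allFin)
open import Data.Nat.ListAction using (sum)
open import Data.List.Membership.Propositional using (_∈_)
open import Data.List.Relation.Binary.Permutation.Propositional using (_↭_)
open import Data.Maybe using (Maybe; just; nothing; _<∣>_)
open import Data.Product using (Σ; ∃; _×_; _,_)
open import Relation.Binary.PropositionalEquality using (_≡_)
open import Relation.Nullary using (¬_)

data OneExpr : Set where
  one  : OneExpr
  plus : OneExpr → OneExpr → OneExpr
  times : OneExpr → OneExpr → OneExpr

valueOf : OneExpr → ℕ
valueOf one = 1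
valueOf (plus a b) = valueOf a + valueOf b
valueOf (times a b) = valueOf a * valueOf b

onesOf : OneExpr → ℕ
onesOf one = 1
onesOf (plus a b) = onesOf a + onesOf b
onesOf (times a b) = onesOf a + onesOf b

IsComplexity : ℕ → ℕ → Set
IsComplexity n m =
  (Σ OneExpr λ e → valueOf e ≡ n × onesOf e ≡ m)
  × (∀ (e : OneExpr) → valueOf e ≡ n → m ≤ onesOf e)

data LDExpr (r : ℕ) : Set where
  const : ℕ → LDExpr r
  mul   : LDExpr r → LDExpr r → LDExpr r
  lin   : LDExpr r → Fin r → ℕ → LDExpr r

vars : ∀ {r} → LDExpr r → List (Fin r)
vars (const c) = []
vars (mul E₁ E₂) = vars E₁ ++ vars E₂
vars (lin E x c) = x ∷ vars E

Disjoint : ∀ {r} → List (Fin r) → List (Fin r) → Set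
Disjoint xs ys = ∀ {x} → x ∈ xs → ¬ (x ∈ ys)

data IsLowDefect {r : ℕ} : LDExpr r → Set where
  constLD : ∀ {c} → 1 ≤ c → IsLowDefect (const c)
  mulLD   : ∀ {E₁ E₂} → IsLowDefect E₁ → IsLowDefect E₂ →
            Disjoint (vars E₁) (vars E₂) → IsLowDefect (mul E₁ E₂)
  linLD   : ∀ {E x c} → IsLowDefect E → ¬ (x ∈ vars E) → 1 ≤ c →
            IsLowDefect (lin E x c)

data HasCost {r : ℕ} : LDExpr r → ℕ → Set where
  constC : ∀ {c m} → IsComplexity c m → HasCost (const c) m
  mulC   : ∀ {E₁ E₂ m₁ m₂} → HasCost E₁ m₁ → HasCost E₂ m₂ →
           HasCost (mul E₁ E₂) (m₁ + m₂)
  linC   : ∀ {E x c m m'} → HasCost E m → IsComplexity c m' →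
           HasCost (lin E x c) (m + m')

eval : ∀ {r} → LDExpr r → (Fin r → ℕ) → ℕ
eval (const c) ρ = c
eval (mul E₁ E₂) ρ = eval E₁ ρ * eval E₂ ρ
eval (lin E x c) ρ = eval E ρ * ρ x + c

-- coefficient of the top monomial (product of all variables of E):
-- for E₁·E₂ (disjoint variables) it is the product of the top coefficients,
-- for E·x + c it is the top coefficient of E, for a constant c it is c.
leadCoeff : ∀ {r} → LDExpr r → ℕ
leadCoeff (const c) = c
leadCoeff (mul E₁ E₂) = leadCoeff E₁ * leadCoeff E₂
leadCoeff (lin E x c) = leadCoeff E

-- the smallest low-defect subexpression of E containing the variable y
-- (this is the subexpression E'·y + c in which y is introduced)
smallestContaining : ∀ {r} → LDExpr r → Fin r → Maybe (LDExpr r)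
smallestContaining (const c) y = nothing
smallestContaining (mul E₁ E₂) y =
  smallestContaining E₁ y <∣> smallestContaining E₂ y
smallestContaining (lin E x c) y with x Data.Fin.≟ y
... | Relation.Nullary.yes _ = just (lin E x c)
... | Relation.Nullary.no _ = smallestContaining E y

NestLE : ∀ {r} → LDExpr r → Fin r → Fin r → Set
NestLE {r} E x y =
  Σ (LDExpr r) λ S → smallestContaining E y ≡ just S × x ∈ vars S

NestMinimal : ∀ {r} → LDExpr r → Fin r → Set
NestMinimal E x = ∀ y → NestLE E y x → y ≡ x

-- (E, C) presents a low-defect pair (f, C) of degree r, f = eval E:
-- E is a low-defect expression in exactly the variables x_0 … x_{r-1}
-- and ‖E‖ ≤ C.
LowDefectPair : (r : ℕ) → LDExpr r → ℕ → Set
LowDefectPair r E C =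
  IsLowDefect E × vars E ↭ allFin r × (∃ λ m → HasCost E m × m ≤ C)

-- For a nonnegative rational s = p / q (q ≥ 1):
-- s < δ(f,C) = C − 3 log₃ a   ⇔   a^(3q) · 3^p < 3^(qC)
RatLtDefect : ∀ {r} → LDExpr r → ℕ → ℕ → ℕ → Set
RatLtDefect E C p q = leadCoeff E ^ (3 * q) * 3 ^ p < 3 ^ (q * C)

-- δ_{f,C}(k) = C + 3 Σ kᵢ − 3 log₃ f(3^k₁,…,3^k_r) < s = p / q
--   ⇔   3^(q(C + 3 Σ kᵢ)) < f(3^k)^(3q) · 3^p
DefectAtLtRat : ∀ {r} → LDExpr r → ℕ → (Fin r → ℕ) → ℕ → ℕ → Set
DefectAtLtRat {r} E C k p q =
  3 ^ (q * (C + 3 * sum (map k (allFin r))))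
    < eval E (λ i → 3 ^ k i) ^ (3 * q) * 3 ^ p

{-# OPTIONS --safe #-}
module Submission where

-- Every scope (subexpression E·x + c introducing a variable x) of a low-defect expression
-- contains a variable that is minimal in the nesting ordering. So if kᵢ > K for every minimal
-- xᵢ, the kᵢ over every scope sum to more than K; as each non-leading monomial of f omits a
-- whole scope, f(3^k) ≤ 3^(Σk)·(a + G·3^(-K)) with G = f(1,…,1) − a. Then
-- δ_{f,C}(k) ≥ C − 3 log₃ (a + G·3^(-K)), which is at least s = p/q as soon as
-- (a + G·3^(-K))^(3q) ≤ a^(3q) + 3^(-p); by the mean value theorem K = 3q·G·(a + G)^(3q−1)·3^p
-- suffices.

open import Defs
open import Data.Nat using (ℕ; zero; suc; pred; _+_; _*_; _^_; _≤_; _<_; _≤?_; z≤n; s≤s; NonZero)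
open import Data.Nat.Properties
open import Data.Nat.Tactic.RingSolver using (solve-∀)
open import Data.Nat.ListAction using (sum; product)
open import Data.Nat.ListAction.Properties using (product-++; product-↭; ∈⇒≤product)
open import Data.Fin as Fin using (Fin)
open import Data.List using ([]; _∷_; _++_; map; allFin)
open import Data.List.Properties using (map-++)
open import Data.List.Membership.Propositional using (_∈_; lose; find)
open import Data.List.Membership.Propositional.Properties using (∈-++⁺ˡ; ∈-++⁺ʳ; ∈-++⁻; ∈-map⁺)
open import Data.List.Relation.Unary.Any using (Any; here; there)
open import Data.List.Relation.Unary.Any.Properties using (¬Any[])
open import Data.List.Relation.Unary.All using (universal)
open import Data.List.Relation.Unary.All.Properties using () renaming (map⁺ to All-map⁺)
open import Data.List.Relation.Binary.Permutation.Propositional.Properties using () renaming (map⁺ to ↭-map⁺)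
open import Data.Maybe using (just; nothing)
open import Data.Maybe.Properties using (just-injective)
open import Data.Product using (∃; _×_; _,_)
open import Data.Sum using (_⊎_; inj₁; inj₂)
open import Data.Empty using (⊥-elim)
open import Function using (_∘_)
open import Relation.Binary.PropositionalEquality
open import Relation.Nullary using (¬_; yes; no)
open import Relation.Unary using (Decidable)

private
  variable
    r c : ℕ
    x y : Fin r
    E E₁ E₂ Et : LDExpr r

^-distribʳ-* : ∀ m n o → (m * n) ^ o ≡ m ^ o * n ^ o
^-distribʳ-* m n zero = refl
^-distribʳ-* m n (suc o) = trans (cong (m * n *_) (^-distribʳ-* m n o)) (interchange m n (m ^ o) (n ^ o))
  where
    interchange : ∀ m n x y → m * n * (x * y) ≡ m * x * (n * y)
    interchange = solve-∀

^-meanValue-≤ : ∀ u g {w} m → u + g ≤ w → (u + g) ^ suc m ≤ u ^ suc m + suc m * g * w ^ m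
^-meanValue-≤ u g zero _ = ≤-reflexive (solve u g)
  where
    solve : ∀ u g → (u + g) * 1 ≡ u * 1 + (g + 0) * 1
    solve = solve-∀
^-meanValue-≤ u g {w} (suc m) u+g≤w = begin
  (u + g) * (u + g) ^ suc m                      ≤⟨ *-monoʳ-≤ (u + g) (^-meanValue-≤ u g m u+g≤w) ⟩
  (u + g) * (u ^ suc m + suc m * g * w ^ m)      ≡⟨ expand u g (u ^ suc m) (suc m * g * w ^ m) ⟩
  u * u ^ suc m + g * u ^ suc m + (u + g) * (suc m * g * w ^ m)
    ≤⟨ +-mono-≤ (+-monoʳ-≤ (u * u ^ suc m) (*-monoʳ-≤ g (^-monoˡ-≤ (suc m) u≤w)))
                (*-monoˡ-≤ (suc m * g * w ^ m) u+g≤w) ⟩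
  u * u ^ suc m + g * (w * w ^ m) + w * (suc m * g * w ^ m) ≡⟨ collect (u * u ^ suc m) g w (w ^ m) m ⟩
  u * u ^ suc m + suc (suc m) * g * (w * w ^ m)  ∎
  where
    open ≤-Reasoning
    u≤w : u ≤ w
    u≤w = ≤-trans (m≤m+n u g) u+g≤w
    expand : ∀ u g x y → (u + g) * (x + y) ≡ u * x + g * x + (u + g) * y
    expand = solve-∀
    collect : ∀ x g w y m → x + g * (w * y) + w * ((1 + m) * g * y) ≡ x + (2 + m) * g * (w * y)
    collect = solve-∀

-- F ≤ (a + G/T)·X and the mean value theorem, with denominators cleared.
^-perturbation-≤ : ∀ {a G T X F P} m .{{_ : NonZero T}} →
  suc m * G * (a + G) ^ m * P ≤ T → F * T ≤ (a * T + G) * X →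
  F ^ suc m * P ≤ suc (a ^ suc m * P) * X ^ suc m
^-perturbation-≤ {a} {G} {T} {X} {F} {P} m B≤T FT≤ = *-cancelʳ-≤ _ _ (T ^ n) {{m^n≢0 T n}} (begin
  F ^ n * P * T ^ n                                  ≡⟨ swap (F ^ n) P (T ^ n) ⟩
  F ^ n * T ^ n * P                                  ≡⟨ cong (_* P) (sym (^-distribʳ-* F T n)) ⟩
  (F * T) ^ n * P                                    ≤⟨ *-monoˡ-≤ P (^-monoˡ-≤ n FT≤) ⟩
  ((a * T + G) * X) ^ n * P                          ≡⟨ cong (_* P) (^-distribʳ-* (a * T + G) X n) ⟩
  (a * T + G) ^ n * X ^ n * P
    ≤⟨ *-monoˡ-≤ P (*-monoˡ-≤ (X ^ n) (^-meanValue-≤ (a * T) G m aT+G≤[a+G]T)) ⟩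
  ((a * T) ^ n + n * G * ((a + G) * T) ^ m) * X ^ n * P
    ≡⟨ cong₂ (λ u v → (u + n * G * v) * X ^ n * P) (^-distribʳ-* a T n) (^-distribʳ-* (a + G) T m) ⟩
  (a ^ n * T ^ n + n * G * ((a + G) ^ m * T ^ m)) * X ^ n * P
    ≡⟨ regroup (a ^ n) (T ^ n) (n * G) ((a + G) ^ m) (T ^ m) (X ^ n) P ⟩
  (a ^ n * P * T ^ n + n * G * (a + G) ^ m * P * T ^ m) * X ^ n
    ≤⟨ *-monoˡ-≤ (X ^ n) (+-monoʳ-≤ (a ^ n * P * T ^ n) (*-monoˡ-≤ (T ^ m) B≤T)) ⟩
  (a ^ n * P * T ^ n + T ^ n) * X ^ n                ≡⟨ collect (a ^ n * P) (T ^ n) (X ^ n) ⟩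
  suc (a ^ n * P) * X ^ n * T ^ n                    ∎)
  where
    open ≤-Reasoning
    n = suc m
    aT+G≤[a+G]T : a * T + G ≤ (a + G) * T
    aT+G≤[a+G]T = ≤-trans (+-monoʳ-≤ (a * T) (m≤m*n G T)) (≤-reflexive (sym (*-distribʳ-+ T a G)))
    swap : ∀ x p t → x * p * t ≡ x * t * p
    swap = solve-∀
    regroup : ∀ x t g b s y p → (x * t + g * (b * s)) * y * p ≡ (x * p * t + g * b * p * s) * y
    regroup = solve-∀
    collect : ∀ x t y → (x * t + t) * y ≡ suc x * y * t
    collect = solve-∀

n<3^n : ∀ n → n < 3 ^ n
n<3^n zero = s≤s z≤n
n<3^n (suc n) = ≤-trans (s≤s (n<3^n n)) (+-mono-≤ (m^n>0 3 n) (m≤m+n (3 ^ n) _))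

product-map-^ : ∀ {A : Set} b (k : A → ℕ) xs → product (map (λ x → b ^ k x) xs) ≡ b ^ sum (map k xs)
product-map-^ b k [] = refl
product-map-^ b k (x ∷ xs) =
  trans (cong (b ^ k x *_) (product-map-^ b k xs)) (sym (^-distribˡ-+-* b (k x) (sum (map k xs))))

b^qC*[b^N]^3q≡b^q[C+3N] : ∀ b q C N → b ^ (q * C) * (b ^ N) ^ (3 * q) ≡ b ^ (q * (C + 3 * N))
b^qC*[b^N]^3q≡b^q[C+3N] b q C N = begin
  b ^ (q * C) * (b ^ N) ^ (3 * q)   ≡⟨ cong (b ^ (q * C) *_) (^-*-assoc b N (3 * q)) ⟩
  b ^ (q * C) * b ^ (N * (3 * q))   ≡⟨ sym (^-distribˡ-+-* b (q * C) (N * (3 * q))) ⟩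
  b ^ (q * C + N * (3 * q))         ≡⟨ cong (b ^_) (regroup q C N) ⟩
  b ^ (q * (C + 3 * N))             ∎
  where
    open ≡-Reasoning
    regroup : ∀ q C N → q * C + N * (3 * q) ≡ q * (C + 3 * N)
    regroup = solve-∀

smallestContaining-∉ : ∀ (E : LDExpr r) → ¬ y ∈ vars E → smallestContaining E y ≡ nothing
smallestContaining-∉ (const _) y∉ = refl
smallestContaining-∉ (mul E₁ E₂) y∉
  rewrite smallestContaining-∉ E₁ (y∉ ∘ ∈-++⁺ˡ)
        | smallestContaining-∉ E₂ (y∉ ∘ ∈-++⁺ʳ (vars E₁)) = refl
smallestContaining-∉ {y = y} (lin E x c) y∉ with x Fin.≟ y
... | yes refl = ⊥-elim (y∉ (here refl))
... | no _ = smallestContaining-∉ E (y∉ ∘ there)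

smallestContaining-∈ : ∀ (E : LDExpr r) → y ∈ vars E → ∃ λ S → smallestContaining E y ≡ just S
smallestContaining-∈ (mul E₁ E₂) y∈ with ∈-++⁻ (vars E₁) y∈
... | inj₁ y∈E₁ with smallestContaining-∈ E₁ y∈E₁
...   | S , scope≡ rewrite scope≡ = S , refl
smallestContaining-∈ {y = y} (mul E₁ E₂) y∈ | inj₂ y∈E₂ with smallestContaining E₁ y
...   | just S = S , refl
...   | nothing = smallestContaining-∈ E₂ y∈E₂
smallestContaining-∈ {y = y} (lin E x c) y∈ with x Fin.≟ y
... | yes _ = lin E x c , refl
smallestContaining-∈ (lin E x c) (here y≡x) | no x≢y = ⊥-elim (x≢y (sym y≡x))
smallestContaining-∈ (lin E x c) (there y∈E) | no _ = smallestContaining-∈ E y∈E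

smallestContaining-mulˡ : ∀ (E₁ E₂ : LDExpr r) → y ∈ vars E₁ →
  smallestContaining (mul E₁ E₂) y ≡ smallestContaining E₁ y
smallestContaining-mulˡ E₁ E₂ y∈E₁ with smallestContaining-∈ E₁ y∈E₁
... | S , scope≡ rewrite scope≡ = refl

smallestContaining-mulʳ : ∀ (E₁ E₂ : LDExpr r) → ¬ y ∈ vars E₁ →
  smallestContaining (mul E₁ E₂) y ≡ smallestContaining E₂ y
smallestContaining-mulʳ E₁ E₂ y∉E₁ rewrite smallestContaining-∉ E₁ y∉E₁ = refl

smallestContaining-linʳ : ∀ (E : LDExpr r) x c → x ≢ y →
  smallestContaining (lin E x c) y ≡ smallestContaining E y
smallestContaining-linʳ {y = y} E x c x≢y with x Fin.≟ y
... | yes x≡y = ⊥-elim (x≢y x≡y)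
... | no _ = refl

smallestContaining-self : ∀ (E : LDExpr r) x c → smallestContaining (lin E x c) x ≡ just (lin E x c)
smallestContaining-self E x c with x Fin.≟ x
... | yes _ = refl
... | no x≢x = ⊥-elim (x≢x refl)

-- The scope of x in Et is smallestContaining Et x, the subexpression E·x + c introducing x.
-- SameScopes E Et holds for every subexpression E of a low-defect expression Et.
record SameScopes (E Et : LDExpr r) : Set where
  constructor sameScopes
  field scope-≡ : ∀ {y} → y ∈ vars E → smallestContaining Et y ≡ smallestContaining E y
open SameScopes

sameScopes-refl : SameScopes E E
sameScopes-refl = sameScopes λ _ → refl

sameScopes-mulˡ : SameScopes (mul E₁ E₂) Et → SameScopes E₁ Et
sameScopes-mulˡ {E₁ = E₁} {E₂} same = sameScopes λ y∈E₁ →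
  trans (scope-≡ same (∈-++⁺ˡ y∈E₁)) (smallestContaining-mulˡ E₁ E₂ y∈E₁)

sameScopes-mulʳ : Disjoint (vars E₁) (vars E₂) → SameScopes (mul E₁ E₂) Et → SameScopes E₂ Et
sameScopes-mulʳ {E₁ = E₁} {E₂} disjoint same = sameScopes λ y∈E₂ →
  trans (scope-≡ same (∈-++⁺ʳ (vars E₁) y∈E₂))
        (smallestContaining-mulʳ E₁ E₂ (λ y∈E₁ → disjoint y∈E₁ y∈E₂))

sameScopes-lin : ¬ x ∈ vars E → SameScopes (lin E x c) Et → SameScopes E Et
sameScopes-lin {x = x} {E = E} {c = c} x∉E same = sameScopes λ y∈E →
  trans (scope-≡ same (there y∈E)) (smallestContaining-linʳ E x c (λ { refl → x∉E y∈E }))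

nestMinimal-lin : vars E ≡ [] → SameScopes (lin E x c) Et → NestMinimal Et x
nestMinimal-lin {E = E} {x = x} {c = c} noVars same z (S , scope≡ , z∈S) =
  only-x (subst (λ S → z ∈ vars S) S≡scope z∈S)
  where
    S≡scope : S ≡ lin E x c
    S≡scope = just-injective
      (trans (sym scope≡) (trans (scope-≡ same (here refl)) (smallestContaining-self E x c)))
    only-x : z ∈ vars (lin E x c) → z ≡ x
    only-x (here z≡x) = z≡x
    only-x (there z∈E) = ⊥-elim (¬Any[] (subst (z ∈_) noVars z∈E))

noVars⊎nestMinimal : IsLowDefect E → SameScopes E Et →
  vars E ≡ [] ⊎ ∃ λ y → y ∈ vars E × NestMinimal Et y
noVars⊎nestMinimal (constLD _) same = inj₁ refl
noVars⊎nestMinimal {E = mul E₁ E₂} (mulLD ld₁ ld₂ disjoint) same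
  with noVars⊎nestMinimal ld₁ (sameScopes-mulˡ same)
     | noVars⊎nestMinimal ld₂ (sameScopes-mulʳ disjoint same)
... | inj₂ (y , y∈E₁ , min) | _ = inj₂ (y , ∈-++⁺ˡ y∈E₁ , min)
... | inj₁ _ | inj₂ (y , y∈E₂ , min) = inj₂ (y , ∈-++⁺ʳ (vars E₁) y∈E₂ , min)
... | inj₁ noVars₁ | inj₁ noVars₂ = inj₁ (cong₂ _++_ noVars₁ noVars₂)
noVars⊎nestMinimal (linLD ld x∉E _) same
  with noVars⊎nestMinimal ld (sameScopes-lin x∉E same)
... | inj₁ noVars = inj₂ (_ , here refl , nestMinimal-lin noVars same)
... | inj₂ (y , y∈E , min) = inj₂ (y , there y∈E , min)

nestMinimal-scope : IsLowDefect (lin E x c) → SameScopes (lin E x c) Et →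
  ∃ λ y → y ∈ vars (lin E x c) × NestMinimal Et y
nestMinimal-scope ld same with noVars⊎nestMinimal ld same
... | inj₂ found = found
... | inj₁ ()

data AllScopes {r} (Q : LDExpr r → Set) : LDExpr r → Set where
  const : AllScopes Q (const c)
  mul   : AllScopes Q E₁ → AllScopes Q E₂ → AllScopes Q (mul E₁ E₂)
  lin   : AllScopes Q E → Q (lin E x c) → AllScopes Q (lin E x c)

allScopes-map : ∀ {Q Q′ : LDExpr r → Set} → (∀ {S} → Q S → Q′ S) → AllScopes Q E → AllScopes Q′ E
allScopes-map f const = const
allScopes-map f (mul all₁ all₂) = mul (allScopes-map f all₁) (allScopes-map f all₂)
allScopes-map f (lin all q) = lin (allScopes-map f all) (f q)

nestMinimal⊎allScopes : ∀ {P : Fin r → Set} → Decidable P → IsLowDefect E → SameScopes E Et →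
  (∃ λ i → NestMinimal Et i × P i) ⊎ AllScopes (λ S → Any (¬_ ∘ P) (vars S)) E
nestMinimal⊎allScopes P? (constLD _) same = inj₂ const
nestMinimal⊎allScopes P? (mulLD ld₁ ld₂ disjoint) same
  with nestMinimal⊎allScopes P? ld₁ (sameScopes-mulˡ same)
     | nestMinimal⊎allScopes P? ld₂ (sameScopes-mulʳ disjoint same)
... | inj₁ found | _ = inj₁ found
... | inj₂ _ | inj₁ found = inj₁ found
... | inj₂ all₁ | inj₂ all₂ = inj₂ (mul all₁ all₂)
nestMinimal⊎allScopes P? ld@(linLD ld′ x∉E _) same
  with nestMinimal⊎allScopes P? ld′ (sameScopes-lin x∉E same)
... | inj₁ found = inj₁ found
... | inj₂ all with nestMinimal-scope ld same
...   | y , y∈ , min with P? y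
...     | yes Py = inj₁ (y , min , Py)
...     | no ¬Py = inj₂ (lin all (lose y∈ ¬Py))

-- f(1,…,1) − a, the sum of the coefficients of the non-leading monomials of f
lowerCoeffSum : LDExpr r → ℕ
lowerCoeffSum (const _) = 0
lowerCoeffSum (mul E₁ E₂) =
  leadCoeff E₁ * lowerCoeffSum E₂ + leadCoeff E₂ * lowerCoeffSum E₁ + lowerCoeffSum E₁ * lowerCoeffSum E₂
lowerCoeffSum (lin E _ c) = lowerCoeffSum E + c

leadMonomial : (Fin r → ℕ) → LDExpr r → ℕ
leadMonomial ρ E = product (map ρ (vars E))

leadMonomial-mul : ∀ (ρ : Fin r → ℕ) E₁ E₂ →
  leadMonomial ρ (mul E₁ E₂) ≡ leadMonomial ρ E₁ * leadMonomial ρ E₂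
leadMonomial-mul ρ E₁ E₂ =
  trans (cong product (map-++ ρ (vars E₁) (vars E₂))) (product-++ (map ρ (vars E₁)) (map ρ (vars E₂)))

^-≤-leadMonomial : ∀ b .{{_ : NonZero b}} (k : Fin r → ℕ) {K} S →
  Any (λ i → ¬ k i ≤ K) (vars S) → b ^ K ≤ leadMonomial (λ i → b ^ k i) S
^-≤-leadMonomial b k S large with find large
... | y , y∈S , ky≰K = ≤-trans (^-monoʳ-≤ b (≰⇒≥ ky≰K))
  (∈⇒≤product (All-map⁺ (universal (λ i → m^n≢0 b (k i)) (vars S))) (∈-map⁺ _ y∈S))

eval-≤-leadMonomial : ∀ (ρ : Fin r → ℕ) T .{{_ : NonZero T}} → AllScopes (λ S → T ≤ leadMonomial ρ S) E →
  eval E ρ * T ≤ (leadCoeff E * T + lowerCoeffSum E) * leadMonomial ρ E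
eval-≤-leadMonomial {E = const c} ρ T const = ≤-reflexive (solve c T)
  where
    solve : ∀ c T → c * T ≡ (c * T + 0) * 1
    solve = solve-∀
eval-≤-leadMonomial {E = lin E x c} ρ T (lin all T≤scope) = begin
  (A * ρ x + c) * T                        ≡⟨ expand A (ρ x) c T ⟩
  A * T * ρ x + c * T                      ≤⟨ +-mono-≤ (*-monoˡ-≤ (ρ x) (eval-≤-leadMonomial ρ T all))
                                                       (*-monoʳ-≤ c T≤scope) ⟩
  (a * T + G) * X * ρ x + c * (ρ x * X)    ≡⟨ collect a T G X (ρ x) c ⟩
  (a * T + (G + c)) * (ρ x * X)            ∎
  where
    open ≤-Reasoning
    A = eval E ρ
    a = leadCoeff E
    G = lowerCoeffSum E
    X = leadMonomial ρ E
    expand : ∀ A y c T → (A * y + c) * T ≡ A * T * y + c * T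
    expand = solve-∀
    collect : ∀ a T G X y c → (a * T + G) * X * y + c * (y * X) ≡ (a * T + (G + c)) * (y * X)
    collect = solve-∀
eval-≤-leadMonomial {E = mul E₁ E₂} ρ T (mul all₁ all₂) = *-cancelʳ-≤ _ _ T (begin
  A₁ * A₂ * T * T                                        ≡⟨ regroup A₁ A₂ T ⟩
  (A₁ * T) * (A₂ * T)                                    ≤⟨ *-mono-≤ (eval-≤-leadMonomial ρ T all₁)
                                                                     (eval-≤-leadMonomial ρ T all₂) ⟩
  (a₁ * T + G₁) * X₁ * ((a₂ * T + G₂) * X₂)              ≡⟨ expand a₁ a₂ G₁ G₂ X₁ X₂ T ⟩
  (a₁ * a₂ * T * T + (a₁ * G₂ + a₂ * G₁) * T + G₁ * G₂) * (X₁ * X₂)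
    ≤⟨ *-monoˡ-≤ (X₁ * X₂) (+-monoʳ-≤ (a₁ * a₂ * T * T + (a₁ * G₂ + a₂ * G₁) * T) (m≤m*n (G₁ * G₂) T)) ⟩
  (a₁ * a₂ * T * T + (a₁ * G₂ + a₂ * G₁) * T + G₁ * G₂ * T) * (X₁ * X₂)
    ≡⟨ collect a₁ a₂ G₁ G₂ X₁ X₂ T ⟩
  (a₁ * a₂ * T + (a₁ * G₂ + a₂ * G₁ + G₁ * G₂)) * (X₁ * X₂) * T
    ≡⟨ cong (λ X → (a₁ * a₂ * T + lowerCoeffSum (mul E₁ E₂)) * X * T) (sym (leadMonomial-mul ρ E₁ E₂)) ⟩
  (a₁ * a₂ * T + lowerCoeffSum (mul E₁ E₂)) * leadMonomial ρ (mul E₁ E₂) * T ∎)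
  where
    open ≤-Reasoning
    A₁ = eval E₁ ρ
    A₂ = eval E₂ ρ
    a₁ = leadCoeff E₁
    a₂ = leadCoeff E₂
    G₁ = lowerCoeffSum E₁
    G₂ = lowerCoeffSum E₂
    X₁ = leadMonomial ρ E₁
    X₂ = leadMonomial ρ E₂
    regroup : ∀ A₁ A₂ T → A₁ * A₂ * T * T ≡ (A₁ * T) * (A₂ * T)
    regroup = solve-∀
    expand : ∀ a₁ a₂ G₁ G₂ X₁ X₂ T → (a₁ * T + G₁) * X₁ * ((a₂ * T + G₂) * X₂)
      ≡ (a₁ * a₂ * T * T + (a₁ * G₂ + a₂ * G₁) * T + G₁ * G₂) * (X₁ * X₂)
    expand = solve-∀
    collect : ∀ a₁ a₂ G₁ G₂ X₁ X₂ T → (a₁ * a₂ * T * T + (a₁ * G₂ + a₂ * G₁) * T + G₁ * G₂ * T) * (X₁ * X₂)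
      ≡ (a₁ * a₂ * T + (a₁ * G₂ + a₂ * G₁ + G₁ * G₂)) * (X₁ * X₂) * T
    collect = solve-∀

corollary4p7 : (r : ℕ) → 0 < r → (E : LDExpr r) → (C : ℕ) →
    LowDefectPair r E C →
    (p q : ℕ) → 1 ≤ q → RatLtDefect E C p q →
    ∃ λ (K : ℕ) → ∀ (k : Fin r → ℕ) → DefectAtLtRat E C k p q →
      ∃ λ (i : Fin r) → NestMinimal E i × k i ≤ K
corollary4p7 r _ E C (lowDefect , vars↭allFin , _) p q@(suc _) _ a^3q*3^p<3^qC = K , minimalBelowK
  where
    a = leadCoeff E
    G = lowerCoeffSum E
    m = pred (3 * q)
    K = 3 * q * G * (a + G) ^ m * 3 ^ p

    instance
      3^K≢0 : NonZero (3 ^ K)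
      3^K≢0 = m^n≢0 3 K

    minimalBelowK : ∀ k → DefectAtLtRat E C k p q → ∃ λ i → NestMinimal E i × k i ≤ K
    minimalBelowK k defect<s with nestMinimal⊎allScopes (λ i → k i ≤? K) lowDefect sameScopes-refl
    ... | inj₁ found = found
    ... | inj₂ largeInScopes = ⊥-elim (<⇒≱ defect<s (begin
      F ^ (3 * q) * 3 ^ p                      ≤⟨ ^-perturbation-≤ {a = a} {G} {X = X} {F} m
                                                    (<⇒≤ (n<3^n K)) evalBound ⟩
      suc (a ^ (3 * q) * 3 ^ p) * X ^ (3 * q)  ≤⟨ *-monoˡ-≤ (X ^ (3 * q)) a^3q*3^p<3^qC ⟩
      3 ^ (q * C) * X ^ (3 * q)                ≡⟨ cong (λ X → 3 ^ (q * C) * X ^ (3 * q)) X≡3^Σk ⟩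
      3 ^ (q * C) * (3 ^ Σk) ^ (3 * q)         ≡⟨ b^qC*[b^N]^3q≡b^q[C+3N] 3 q C Σk ⟩
      3 ^ (q * (C + 3 * Σk))                   ∎))
      where
        open ≤-Reasoning
        ρ = λ i → 3 ^ k i
        F = eval E ρ
        X = leadMonomial ρ E
        Σk = sum (map k (allFin r))
        evalBound : F * 3 ^ K ≤ (a * 3 ^ K + G) * X
        evalBound = eval-≤-leadMonomial ρ (3 ^ K)
          (allScopes-map (λ {S} → ^-≤-leadMonomial 3 k S) largeInScopes)
        X≡3^Σk : X ≡ 3 ^ Σk
        X≡3^Σk = trans (product-↭ (↭-map⁺ ρ vars↭allFin)) (product-map-^ 3 k (allFin r))
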